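{- Let $\Delta_c$ be a concrete first-order unification context with $\Delta_c\rhd\Delta$. Then for every equation $T_1\doteq T_2$ in $\Delta_c$ there is an equation $N_1\doteq N_2$ in $\Delta$ with $\mathrm{exp}^{\Delta_c}_k(T_i)=\mathrm{exp}^{\Delta}_k(N_i)$ for $i=1,2$ and all $k$, and for every recursive definition $\underline r=_d T$ in $\Delta_c$ there is a recursive definition $\underline r=_d U$ in $\Delta$ (with $\mathrm{exp}^{\Delta_c}_k(\underline r)=\mathrm{exp}^{\Delta}_k(\underline r)$ for all $k$).
   Context: Fix constructors $c,d,e$ (with arities), unification metavariables, and recursion constants $\underline r,\underline s,\underline t$. Concrete terms $T ::= c\,T_1\cdots T_n \mid H \mid \underline r$; a concrete unification context $\Delta_c$ is a finite list of equations $T_1\doteq T_2$ and definitions $\underline r=_d c\,T_1\cdots T_n$. Flattened: metavariables tagged contractive $H^{\mathrm{con}}$ or recursive $H^{\mathrm{rec}}$; $U ::= c\,N_1\cdots N_n\mid H^{\mathrm{con}}$, $N ::= \underline r\mid H^{\mathrm{rec}}$; a unification context $\Delta$ is a finite collection of equations $U_1\doteq U_2$, $N_1\doteq N_2$, definitions $\underline r=_d U$, possibly $\mathrm{contra}$; unions $\Delta_1,\Delta_2$ rename recursion constants apart as needed. Expansion into $M_\bot ::= c\,(M_\bot)_1\cdots(M_\bot)_n\mid H^{\mathrm{con}}\mid H^{\mathrm{rec}}\mid\bot$: $\mathrm{exp}_0=\bot$; $\mathrm{exp}^{\Delta_c}_{k+1}(c\,T_1\cdots T_n)=c\,(\mathrm{exp}^{\Delta_c}_k(T_1))\cdots$;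 $\mathrm{exp}^{\Delta_c}_{k+1}(H)=H^{\mathrm{rec}}$; $\mathrm{exp}^{\Delta_c}_{k+1}(\underline r)=\mathrm{exp}^{\Delta_c}_{k+1}(\text{body of }\underline r)$; and for flattened terms $\mathrm{exp}^\Delta_{k+1}(H^m)=H^m$, $\mathrm{exp}^\Delta_{k+1}(c\,N_1\cdots N_n)=c\,(\mathrm{exp}^\Delta_k(N_1))\cdots$, $\mathrm{exp}^\Delta_{k+1}(\underline r)=\mathrm{exp}^\Delta_{k+1}(U)$ for $\underline r=_dU\in\Delta$. Translation: $H\rhd^{\mathrm{rec}}H^{\mathrm{rec}}\diamond[\,]$; $\underline r\rhd^{\mathrm{rec}}\underline r\diamond[\,]$; if $c\,\overline T\rhd^{\mathrm{con}}U\diamond\Delta$ then $c\,\overline T\rhd^{\mathrm{rec}}\underline r\diamond(\Delta,\underline r=_dU)$ with $\underline r$ fresh; if $T_i\rhd^{\mathrm{rec}}N_i\diamond\Delta_i$ for all $i$ then $c\,T_1\cdots T_n\rhd^{\mathrm{con}}c\,N_1\cdots N_n\diamond(\Delta_1,\dots,\Delta_n)$. Contexts: $[\,]\rhd[\,]$; if $\Delta_c\rhd\Delta_1$, $T_1\rhd^{\mathrm{rec}}N_1\diamond\Delta_2$, $T_2\rhd^{\mathrm{rec}}N_2\diamond\Delta_3$ then $(\Delta_c,T_1\doteq T_2)\rhd(\Delta_1,\Delta_2,\Delta_3,N_1\doteq N_2)$; if $\Delta_c\rhd\Delta_1$ and $c\,\overline T\rhd^{\mathrm{con}}U\diamond\Delta_2$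 then $(\Delta_c,\underline r=_dc\,\overline T)\rhd(\Delta_1,\Delta_2,\underline r=_dU)$. -}

module Defs where

open import Data.Nat using (ℕ; zero; suc; _≤_; _≡ᵇ_)
open import Data.Bool using (Bool; true; false; _∧_; if_then_else_)
open import Data.Maybe using (Maybe; just; nothing)
open import Data.Product using (Σ; _,_)
open import Data.List using (List; []; _∷_; _++_; [_])
open import Data.Vec using (Vec; []; _∷_) renaming (map to vmap)

data Mode : Set where
  con rec : Mode

-- Recursion constants of flattened contexts: the original constants of the
-- concrete context, plus a supply of fresh constants (disjoint from them).
data RC : Set where
  orig  : ℕ → RC
  fresh : ℕ → RC

_=RC_ : RC → RC → Bool
orig a  =RC orig b  = a ≡ᵇ b
fresh a =RC fresh b = a ≡ᵇ b
_       =RC _       = false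

module Syntax (Con : Set) (ar : Con → ℕ) where

  data Tm : Set where
    cn   : (c : Con) → Vec Tm (ar c) → Tm
    meta : ℕ → Tm
    rc   : ℕ → Tm

  data CItem : Set where
    ceq  : Tm → Tm → CItem
    cdef : ℕ → (c : Con) → Vec Tm (ar c) → CItem

  CCtx : Set
  CCtx = List CItem

  data NT : Set where
    rcN  : RC → NT
    mrec : ℕ → NT

  data UT : Set where
    cnU  : (c : Con) → Vec NT (ar c) → UT
    mcon : ℕ → UT

  data FItem : Set where
    eqU    : UT → UT → FItem
    eqN    : NT → NT → FItem
    defU   : RC → UT → FItem
    contra : FItem

  FCtx : Set
  FCtx = List FItem

  data M : Set where
    cnM : (c : Con) → Vec M (ar c) → M
    mv  : Mode → ℕ → M
    bot : M

  clookup : CCtx → ℕ → Maybe (Σ Con (λ c → Vec Tm (ar c)))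
  clookup [] r = nothing
  clookup (ceq _ _ ∷ Δ) r = clookup Δ r
  clookup (cdef s c ts ∷ Δ) r = if s ≡ᵇ r then just (c , ts) else clookup Δ r

  flookup : FCtx → RC → Maybe UT
  flookup [] r = nothing
  flookup (defU s u ∷ Δ) r = if s =RC r then just u else flookup Δ r
  flookup (eqU _ _ ∷ Δ) r = flookup Δ r
  flookup (eqN _ _ ∷ Δ) r = flookup Δ r
  flookup (contra ∷ Δ) r = flookup Δ r

  expC : CCtx → ℕ → Tm → M
  expC Δ zero t = bot
  expC Δ (suc k) (cn c ts) = cnM c (vmap (expC Δ k) ts)
  expC Δ (suc k) (meta h) = mv rec h
  expC Δ (suc k) (rc r) with clookup Δ r
  ... | just (c , ts) = cnM c (vmap (expC Δ k) ts)
  ... | nothing = bot     -- undefined recursion constant: convention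

  expN : FCtx → ℕ → NT → M
  expU : FCtx → ℕ → UT → M
  expU Δ zero u = bot
  expU Δ (suc k) (cnU c ns) = cnM c (vmap (expN Δ k) ns)
  expU Δ (suc k) (mcon h) = mv con h
  expN Δ zero n = bot
  expN Δ (suc k) (mrec h) = mv rec h
  expN Δ (suc k) (rcN r) with flookup Δ r
  ... | just (cnU c ns) = cnM c (vmap (expN Δ k) ns)
  ... | just (mcon h) = mv con h
  ... | nothing = bot     -- undefined recursion constant: convention
  -- (the two `just` clauses are exactly exp_{k+1}(U) for the body U)

  -- Freshness is implemented by a counter: a relation
  --   TrRec n T N Δ n'
  -- means T ▷^rec N ◇ Δ, where all fresh constants used are `fresh s`
  -- with n ≤ s < n'.  A fresh constant is any `fresh s` with s at least
  -- the current counter, so fresh constants are automatically distinct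
  -- from each other and from all original constants (this replaces the
  -- renaming apart of unions).
  data TrRec : ℕ → Tm → NT → FCtx → ℕ → Set
  data TrCon : ℕ → Tm → UT → FCtx → ℕ → Set
  data TrArgs : ∀ {m} → ℕ → Vec Tm m → Vec NT m → FCtx → ℕ → Set

  data TrRec where
    trMeta : ∀ {n h} → TrRec n (meta h) (mrec h) [] n
    trRc   : ∀ {n r} → TrRec n (rc r) (rcN (orig r)) [] n
    trCn   : ∀ {n n' s c ts u Δ} → TrCon n (cn c ts) u Δ n' → n' ≤ s →
             TrRec n (cn c ts) (rcN (fresh s)) (Δ ++ [ defU (fresh s) u ]) (suc s)

  data TrCon where
    trConArgs : ∀ {n n' c ts ns Δ} → TrArgs n ts ns Δ n' →
                TrCon n (cn c ts) (cnU c ns) Δ n'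

  data TrArgs where
    trNil  : ∀ {n} → TrArgs n [] [] [] n
    trCons : ∀ {m n n₁ n₂ t N Δ₁ Δ₂} {ts : Vec Tm m} {ns : Vec NT m} →
             TrRec n t N Δ₁ n₁ → TrArgs n₁ ts ns Δ₂ n₂ →
             TrArgs n (t ∷ ts) (N ∷ ns) (Δ₁ ++ Δ₂) n₂

  -- Contexts: Δc ▷ Δ  (concrete contexts are built by appending at the end)
  data TrCtx : ℕ → CCtx → FCtx → ℕ → Set where
    trEmpty : ∀ {n} → TrCtx n [] [] n
    trEq    : ∀ {n n₁ n₂ n₃ Δc Δ₁ Δ₂ Δ₃ T₁ T₂ N₁ N₂} →
              TrCtx n Δc Δ₁ n₁ → TrRec n₁ T₁ N₁ Δ₂ n₂ → TrRec n₂ T₂ N₂ Δ₃ n₃ →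
              TrCtx n (Δc ++ [ ceq T₁ T₂ ]) (Δ₁ ++ Δ₂ ++ Δ₃ ++ [ eqN N₁ N₂ ]) n₃
    trDef   : ∀ {n n₁ n₂ Δc Δ₁ Δ₂ r c ts u} →
              TrCtx n Δc Δ₁ n₁ → TrCon n₁ (cn c ts) u Δ₂ n₂ →
              TrCtx n (Δc ++ [ cdef r c ts ]) (Δ₁ ++ Δ₂ ++ [ defU (orig r) u ]) n₂

-- Expansion consults nothing but the bodies of recursion constants, so it suffices that every
-- body introduced by a sub-derivation is still the body found by lookup in the final context
-- (D ⊑ Δ).  Lookup returns the first definition, so appending preserves this as long as the
-- earlier part defines none of the same constants: a derivation that moves the counter from n
-- to n′ defines only fresh constants in [n, n′), while everything translated before it lies
-- below n.  Along the context translation one therefore maintains that the body of each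
-- original constant and both sides of each equation are translated by derivations whose
-- contexts are included in Δ; the expansions then agree by induction on the depth k and on the
-- derivation.
module Submission where

open import Defs
open import Data.Nat using (ℕ; zero; suc; _≤_; _<_; _≡ᵇ_)
open import Data.Nat.Properties using (≤-refl; ≤-trans; <-≤-trans; <⇒≱; ≡ᵇ⇒≡; ≡⇒≡ᵇ; m≤n⇒m≤1+n; n<1+n)
open import Data.Bool using (true; false; T)
open import Data.Bool.Properties using (T-≡)
open import Data.Unit using (⊤; tt)
open import Data.Empty using (⊥; ⊥-elim)
open import Data.Maybe using (Maybe; just; nothing; _<∣>_; Is-just)
import Data.Maybe.Relation.Unary.Any as Maybe
open import Data.Product using (Σ; _×_; _,_; proj₁)
open import Data.Sum using ([_,_]′)
open import Data.Vec using (Vec; []; _∷_) renaming (map to vmap)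
open import Data.List using ([]; _∷_; _++_; [_])
open import Data.List.Relation.Unary.All as All using (All; []; _∷_)
open import Data.List.Relation.Unary.All.Properties using (++⁺)
open import Data.List.Relation.Unary.Any using (here; there)
open import Data.List.Membership.Propositional using (_∈_)
open import Data.List.Membership.Propositional.Properties using (∈-++⁻; ∈-++⁺ˡ; ∈-++⁺ʳ)
open import Function using (_∘_)
open import Function.Bundles using (Equivalence)
open import Relation.Binary.PropositionalEquality using (_≡_; refl; sym; trans; cong; cong₂; subst; subst₂)

=RC⇒≡ : ∀ r r′ → T (r =RC r′) → r ≡ r′
=RC⇒≡ (orig a)  (orig b)  p = cong orig (≡ᵇ⇒≡ a b p)
=RC⇒≡ (fresh a) (fresh b) p = cong fresh (≡ᵇ⇒≡ a b p)

≡ᵇ-refl : ∀ n → (n ≡ᵇ n) ≡ true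
≡ᵇ-refl n = Equivalence.to T-≡ (≡⇒≡ᵇ n n refl)

FreshBelow : ℕ → RC → Set
FreshBelow b (orig _)  = ⊤
FreshBelow b (fresh s) = s < b

FreshIn : ℕ → ℕ → RC → Set
FreshIn a b (orig _)  = ⊥
FreshIn a b (fresh s) = a ≤ s × s < b

FreshBelow-mono : ∀ {b b′} → b ≤ b′ → ∀ {r} → FreshBelow b r → FreshBelow b′ r
FreshBelow-mono b≤b′ {orig _}  _   = tt
FreshBelow-mono b≤b′ {fresh _} s<b = <-≤-trans s<b b≤b′

FreshIn-mono : ∀ {a a′ b b′} → a′ ≤ a → b ≤ b′ → ∀ {r} → FreshIn a b r → FreshIn a′ b′ r
FreshIn-mono a′≤a b≤b′ {fresh _} (a≤s , s<b) = ≤-trans a′≤a a≤s , <-≤-trans s<b b≤b′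

FreshIn⇒FreshBelow : ∀ {a b r} → FreshIn a b r → FreshBelow b r
FreshIn⇒FreshBelow {r = fresh _} (_ , s<b) = s<b

module Translation (Con : Set) (ar : Con → ℕ) where
  open Syntax Con ar

  flookup-++ : ∀ A B r → flookup (A ++ B) r ≡ (flookup A r <∣> flookup B r)
  flookup-++ []             B r = refl
  flookup-++ (defU s u ∷ A) B r with s =RC r
  ... | true  = refl
  ... | false = flookup-++ A B r
  flookup-++ (eqU _ _ ∷ A)  B r = flookup-++ A B r
  flookup-++ (eqN _ _ ∷ A)  B r = flookup-++ A B r
  flookup-++ (contra ∷ A)   B r = flookup-++ A B r

  clookup-++ : ∀ A B r → clookup (A ++ B) r ≡ (clookup A r <∣> clookup B r)
  clookup-++ []               B r = refl
  clookup-++ (cdef s _ _ ∷ A) B r with s ≡ᵇ r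
  ... | true  = refl
  ... | false = clookup-++ A B r
  clookup-++ (ceq _ _ ∷ A)    B r = clookup-++ A B r

  flookup-sound : ∀ {D r u} → flookup D r ≡ just u → defU r u ∈ D
  flookup-sound {defU s u ∷ D} {r} eq with s =RC r in s=r
  flookup-sound {defU s u ∷ D} {r} refl | true =
    here (cong₂ defU (sym (=RC⇒≡ s r (subst T (sym s=r) tt))) refl)
  ... | false = there (flookup-sound eq)
  flookup-sound {eqU _ _ ∷ D} eq = there (flookup-sound eq)
  flookup-sound {eqN _ _ ∷ D} eq = there (flookup-sound eq)
  flookup-sound {contra ∷ D}  eq = there (flookup-sound eq)

  clookup-complete : ∀ {Δc r c ts} → cdef r c ts ∈ Δc → Is-just (clookup Δc r)
  clookup-complete {cdef s _ _ ∷ Δc} {r} p with s ≡ᵇ r in s=r | p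
  ... | true  | _         = Maybe.just tt
  ... | false | there q   = clookup-complete q
  ... | false | here refl with () ← trans (sym s=r) (≡ᵇ-refl r)
  clookup-complete {ceq _ _ ∷ Δc} (there q) = clookup-complete q

  KeyIn : (RC → Set) → FItem → Set
  KeyIn P (defU r _) = P r
  KeyIn P _          = ⊤

  DomainIn : (RC → Set) → FCtx → Set
  DomainIn P = All (KeyIn P)

  DomainIn-mono : ∀ {P Q : RC → Set} {D} → (∀ {r} → P r → Q r) → DomainIn P D → DomainIn Q D
  DomainIn-mono {P} {Q} P⇒Q = All.map (λ {x} → KeyIn-mono {x})
    where
    KeyIn-mono : ∀ {x} → KeyIn P x → KeyIn Q x
    KeyIn-mono {defU _ _} = P⇒Q
    KeyIn-mono {eqU _ _}  = _
    KeyIn-mono {eqN _ _}  = _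
    KeyIn-mono {contra}   = _

  DomainIn-lookup : ∀ {P D r u} → DomainIn P D → flookup D r ≡ just u → P r
  DomainIn-lookup dom eq = All.lookup dom (flookup-sound eq)

  orig-undefined : ∀ {a b D} → DomainIn (FreshIn a b) D → ∀ r → flookup D (orig r) ≡ nothing
  orig-undefined {D = D} dom r with flookup D (orig r) in eq
  ... | just _  = ⊥-elim (DomainIn-lookup dom eq)
  ... | nothing = refl

  FreshBelow-FreshIn-disjoint : ∀ {a b A D r u} → DomainIn (FreshBelow a) A → DomainIn (FreshIn a b) D →
                                flookup D r ≡ just u → flookup A r ≡ nothing
  FreshBelow-FreshIn-disjoint {r = orig _}          below inRange eq = ⊥-elim (DomainIn-lookup inRange eq)
  FreshBelow-FreshIn-disjoint {A = A} {r = fresh s} below inRange eq with flookup A (fresh s) in eqA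
  ... | just _  = ⊥-elim (<⇒≱ (DomainIn-lookup below eqA) (proj₁ (DomainIn-lookup inRange eq)))
  ... | nothing = refl

  infix 4 _⊑_
  record _⊑_ (D E : FCtx) : Set where
    constructor mk⊑
    field ⊑-lookup : ∀ {r u} → flookup D r ≡ just u → flookup E r ≡ just u
  open _⊑_

  ⊑-refl : ∀ {D} → D ⊑ D
  ⊑-refl = mk⊑ λ eq → eq

  ⊑-trans : ∀ {D E F} → D ⊑ E → E ⊑ F → D ⊑ F
  ⊑-trans D⊑E E⊑F = mk⊑ λ eq → ⊑-lookup E⊑F (⊑-lookup D⊑E eq)

  D⊑D++E : ∀ {D E} → D ⊑ D ++ E
  D⊑D++E {D} {E} = mk⊑ λ {r} eq → trans (flookup-++ D E r) (cong (_<∣> _) eq)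

  ⊑-++ˡ : ∀ {a b A D E} → DomainIn (FreshBelow a) A → DomainIn (FreshIn a b) D → D ⊑ E → D ⊑ A ++ E
  ⊑-++ˡ {A = A} {E = E} below inRange D⊑E = mk⊑ λ {r} eq →
    trans (flookup-++ A E r)
          (trans (cong (_<∣> _) (FreshBelow-FreshIn-disjoint below inRange eq)) (⊑-lookup D⊑E eq))

  trRec-≤  : ∀ {n T N D n′} → TrRec n T N D n′ → n ≤ n′
  trCon-≤  : ∀ {n T U D n′} → TrCon n T U D n′ → n ≤ n′
  trArgs-≤ : ∀ {m n} {ts : Vec Tm m} {ns D n′} → TrArgs n ts ns D n′ → n ≤ n′
  trRec-≤ trMeta = ≤-refl
  trRec-≤ trRc = ≤-refl
  trRec-≤ (trCn tc n′≤s) = m≤n⇒m≤1+n (≤-trans (trCon-≤ tc) n′≤s)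
  trCon-≤ (trConArgs ta) = trArgs-≤ ta
  trArgs-≤ trNil = ≤-refl
  trArgs-≤ (trCons tr ta) = ≤-trans (trRec-≤ tr) (trArgs-≤ ta)

  trRec-domain  : ∀ {n T N D n′} → TrRec n T N D n′ → DomainIn (FreshIn n n′) D
  trCon-domain  : ∀ {n T U D n′} → TrCon n T U D n′ → DomainIn (FreshIn n n′) D
  trArgs-domain : ∀ {m n} {ts : Vec Tm m} {ns D n′} → TrArgs n ts ns D n′ → DomainIn (FreshIn n n′) D
  trRec-domain trMeta = []
  trRec-domain trRc = []
  trRec-domain (trCn tc n′≤s) = ++⁺
    (DomainIn-mono (FreshIn-mono ≤-refl (m≤n⇒m≤1+n n′≤s)) (trCon-domain tc))
    ((≤-trans (trCon-≤ tc) n′≤s , n<1+n _) ∷ [])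
  trCon-domain (trConArgs ta) = trArgs-domain ta
  trArgs-domain trNil = []
  trArgs-domain (trCons tr ta) = ++⁺
    (DomainIn-mono (FreshIn-mono ≤-refl (trArgs-≤ ta)) (trRec-domain tr))
    (DomainIn-mono (FreshIn-mono (trRec-≤ tr) ≤-refl) (trArgs-domain ta))

  data BodyTranslation (Δ : FCtx) : Maybe (Σ Con (λ c → Vec Tm (ar c))) → Maybe UT → Set where
    undefined : BodyTranslation Δ nothing nothing
    defined   : ∀ {c ts ns m D m′} → TrArgs m ts ns D m′ → D ⊑ Δ →
                BodyTranslation Δ (just (c , ts)) (just (cnU c ns))

  BodyTranslation-⊑ : ∀ {Δ Δ′ x y} → Δ ⊑ Δ′ → BodyTranslation Δ x y → BodyTranslation Δ′ x y
  BodyTranslation-⊑ _    undefined        = undefined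
  BodyTranslation-⊑ Δ⊑Δ′ (defined ta D⊑Δ) = defined ta (⊑-trans D⊑Δ Δ⊑Δ′)

  BodyTranslation-<∣> : ∀ {Δ x x′ y y′} → BodyTranslation Δ x y → BodyTranslation Δ x′ y′ →
                        BodyTranslation Δ (x <∣> x′) (y <∣> y′)
  BodyTranslation-<∣> undefined          bt′ = bt′
  BodyTranslation-<∣> bt@(defined _ _) _   = bt

  BodyTranslation-defined : ∀ {Δ x y} → BodyTranslation Δ x y → Is-just x → Σ UT (λ u → y ≡ just u)
  BodyTranslation-defined (defined _ _) _ = _ , refl

  ConstantsTranslated : CCtx → FCtx → Set
  ConstantsTranslated Δc Δ = ∀ r → BodyTranslation Δ (clookup Δc r) (flookup Δ (orig r))

  module Expansion (Δc : CCtx) (Δ : FCtx) (constants : ConstantsTranslated Δc Δ) where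

    expN-defined : ∀ {k r c ns} → flookup Δ r ≡ just (cnU c ns) →
                   expN Δ (suc k) (rcN r) ≡ cnM c (vmap (expN Δ k) ns)
    expN-defined eq rewrite eq = refl

    expand-trRec  : ∀ k {n T N D n′} → TrRec n T N D n′ → D ⊑ Δ → expC Δc k T ≡ expN Δ k N
    expand-trArgs : ∀ k {m n} {ts : Vec Tm m} {ns D n′} → TrArgs n ts ns D n′ → D ⊑ Δ →
                    vmap (expC Δc k) ts ≡ vmap (expN Δ k) ns
    expand-trRec zero    _      _ = refl
    expand-trRec (suc k) trMeta _ = refl
    expand-trRec (suc k) (trRc {r = r}) _ with clookup Δc r | flookup Δ (orig r) | constants r
    ... | nothing      | nothing | undefined        = refl
    ... | just (c , _) | just _  | defined ta D⊑Δ = cong (cnM c) (expand-trArgs k ta D⊑Δ)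
    expand-trRec (suc k) (trCn {s = s} {c = c} {u = u} (trConArgs ta) n′≤s) D⊑Δ =
      trans (cong (cnM c) (expand-trArgs k ta (⊑-trans D⊑D++E D⊑Δ)))
            (sym (expN-defined (⊑-lookup D⊑Δ (⊑-lookup (⊑-++ˡ below new ⊑-refl) defU-self))))
      where
      below = DomainIn-mono FreshIn⇒FreshBelow (trArgs-domain ta)
      new : DomainIn (FreshIn _ (suc s)) [ defU (fresh s) u ]
      new = (n′≤s , n<1+n s) ∷ []
      defU-self : flookup [ defU (fresh s) u ] (fresh s) ≡ just u
      defU-self rewrite ≡ᵇ-refl s = refl
    expand-trArgs k trNil _ = refl
    expand-trArgs k (trCons tr ta) D⊑Δ =
      cong₂ _∷_ (expand-trRec k tr (⊑-trans D⊑D++E D⊑Δ))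
                (expand-trArgs k ta (⊑-trans (⊑-++ˡ below (trArgs-domain ta) ⊑-refl) D⊑Δ))
      where
      below = DomainIn-mono FreshIn⇒FreshBelow (trRec-domain tr)

  data TermTranslation (Δ : FCtx) (T : Tm) (N : NT) : Set where
    translated : ∀ {m D m′} → TrRec m T N D m′ → D ⊑ Δ → TermTranslation Δ T N

  TermTranslation-⊑ : ∀ {Δ Δ′ T N} → Δ ⊑ Δ′ → TermTranslation Δ T N → TermTranslation Δ′ T N
  TermTranslation-⊑ Δ⊑Δ′ (translated tr D⊑Δ) = translated tr (⊑-trans D⊑Δ Δ⊑Δ′)

  EquationTranslation : FCtx → Tm → Tm → Set
  EquationTranslation Δ T₁ T₂ =
    Σ NT λ N₁ → Σ NT λ N₂ → eqN N₁ N₂ ∈ Δ × TermTranslation Δ T₁ N₁ × TermTranslation Δ T₂ N₂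

  EquationTranslation-++ : ∀ {Δ B T₁ T₂} → EquationTranslation Δ T₁ T₂ → EquationTranslation (Δ ++ B) T₁ T₂
  EquationTranslation-++ (N₁ , N₂ , p , t₁ , t₂) =
    N₁ , N₂ , ∈-++⁺ˡ p , TermTranslation-⊑ D⊑D++E t₁ , TermTranslation-⊑ D⊑D++E t₂

  record Invariant (Δc : CCtx) (Δ : FCtx) (b : ℕ) : Set where
    field
      fresh-below : DomainIn (FreshBelow b) Δ
      constants   : ConstantsTranslated Δc Δ
      equations   : ∀ {T₁ T₂} → ceq T₁ T₂ ∈ Δc → EquationTranslation Δ T₁ T₂
  open Invariant

  Invariant-++ : ∀ {Δc Δ Bc B b b′} → Invariant Δc Δ b → b ≤ b′ → DomainIn (FreshBelow b′) B →
                 (∀ r → BodyTranslation (Δ ++ B) (clookup Bc r) (flookup B (orig r))) →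
                 (∀ {T₁ T₂} → ceq T₁ T₂ ∈ Bc → EquationTranslation (Δ ++ B) T₁ T₂) →
                 Invariant (Δc ++ Bc) (Δ ++ B) b′
  Invariant-++ {Δc} {Δ} {Bc} {B} I b≤b′ below new-constants new-equations = record
    { fresh-below = ++⁺ (DomainIn-mono (FreshBelow-mono b≤b′) (fresh-below I)) below
    ; constants   = λ r → subst₂ (BodyTranslation (Δ ++ B))
        (sym (clookup-++ Δc Bc r)) (sym (flookup-++ Δ B (orig r)))
        (BodyTranslation-<∣> (BodyTranslation-⊑ D⊑D++E (constants I r)) (new-constants r))
    ; equations   = λ p → [ EquationTranslation-++ ∘ equations I , new-equations ]′ (∈-++⁻ Δc p)
    }

  invariant : ∀ {n Δc Δ n′} → TrCtx n Δc Δ n′ → Invariant Δc Δ n′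
  invariant trEmpty = record { fresh-below = [] ; constants = λ _ → undefined ; equations = λ () }
  invariant (trEq {Δ₁ = Δ₁} {Δ₂} {Δ₃} {N₁ = N₁} {N₂} tc tr₁ tr₂) =
    Invariant-++ I (≤-trans (trRec-≤ tr₁) (trRec-≤ tr₂)) (DomainIn-mono FreshIn⇒FreshBelow dom)
      new-constant new-equation
    where
    I = invariant tc
    dom₂ = trRec-domain tr₁
    dom₃ = trRec-domain tr₂
    B = Δ₂ ++ Δ₃ ++ [ eqN N₁ N₂ ]
    dom : DomainIn (FreshIn _ _) B
    dom = ++⁺ (DomainIn-mono (FreshIn-mono ≤-refl (trRec-≤ tr₂)) dom₂)
              (++⁺ (DomainIn-mono (FreshIn-mono (trRec-≤ tr₁) ≤-refl) dom₃) (tt ∷ []))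
    new-constant : ∀ r → BodyTranslation (Δ₁ ++ B) nothing (flookup B (orig r))
    new-constant r rewrite orig-undefined dom r = undefined
    new-equation : ∀ {T₁ T₂} → ceq T₁ T₂ ∈ [ ceq _ _ ] → EquationTranslation (Δ₁ ++ B) T₁ T₂
    new-equation (here refl) =
      N₁ , N₂ , ∈-++⁺ʳ Δ₁ (∈-++⁺ʳ Δ₂ (∈-++⁺ʳ Δ₃ (here refl))) ,
      translated tr₁ (⊑-++ˡ (fresh-below I) dom₂ D⊑D++E) ,
      translated tr₂ (⊑-++ˡ (DomainIn-mono (FreshBelow-mono (trRec-≤ tr₁)) (fresh-below I)) dom₃
                       (⊑-++ˡ (DomainIn-mono FreshIn⇒FreshBelow dom₂) dom₃ D⊑D++E))
  invariant (trDef {Δ₁ = Δ₁} {Δ₂} {r = r₀} {c} {ts} tc (trConArgs {ns = ns} ta)) =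
    Invariant-++ I (trArgs-≤ ta) (++⁺ (DomainIn-mono FreshIn⇒FreshBelow dom) (tt ∷ []))
      new-constant (λ { (here ()) ; (there ()) })
    where
    I = invariant tc
    dom = trArgs-domain ta
    B = Δ₂ ++ [ defU (orig r₀) (cnU c ns) ]
    new-constant : ∀ r → BodyTranslation (Δ₁ ++ B) (clookup [ cdef r₀ c ts ] r) (flookup B (orig r))
    new-constant r rewrite flookup-++ Δ₂ [ defU (orig r₀) (cnU c ns) ] (orig r) | orig-undefined dom r
      with r₀ ≡ᵇ r
    ... | true  = defined ta (⊑-++ˡ (fresh-below I) dom D⊑D++E)
    ... | false = undefined

  module _ {n Δc Δ n′} (tr : TrCtx n Δc Δ n′) where
    open Expansion Δc Δ (constants (invariant tr))

    equation-expansions : ∀ {T₁ T₂} → ceq T₁ T₂ ∈ Δc →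
      Σ NT λ N₁ → Σ NT λ N₂ → eqN N₁ N₂ ∈ Δ
        × (∀ k → expC Δc k T₁ ≡ expN Δ k N₁) × (∀ k → expC Δc k T₂ ≡ expN Δ k N₂)
    equation-expansions p with equations (invariant tr) p
    ... | N₁ , N₂ , q , translated tr₁ ⊑₁ , translated tr₂ ⊑₂ =
      N₁ , N₂ , q , (λ k → expand-trRec k tr₁ ⊑₁) , (λ k → expand-trRec k tr₂ ⊑₂)

    definition-expansion : ∀ {r c ts} → cdef r c ts ∈ Δc →
      Σ UT λ U → defU (orig r) U ∈ Δ × (∀ k → expC Δc k (rc r) ≡ expN Δ k (rcN (orig r)))
    definition-expansion {r} p with BodyTranslation-defined (constants (invariant tr) r) (clookup-complete p)
    ... | U , eq = U , flookup-sound eq , λ k → expand-trRec k (trRc {n = 0}) (mk⊑ λ ())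

corollary2p2 : (Con : Set) (ar : Con → ℕ) → let open Syntax Con ar in
    (Δc : CCtx) (Δ : FCtx) (n n' : ℕ) → TrCtx n Δc Δ n' →
      ((T₁ T₂ : Tm) → ceq T₁ T₂ ∈ Δc →
        Σ NT (λ N₁ → Σ NT (λ N₂ → eqN N₁ N₂ ∈ Δ
          × ((k : ℕ) → expC Δc k T₁ ≡ expN Δ k N₁)
          × ((k : ℕ) → expC Δc k T₂ ≡ expN Δ k N₂))))
      × ((r : ℕ) (c : Con) (ts : Vec Tm (ar c)) → cdef r c ts ∈ Δc →
        Σ UT (λ U → defU (orig r) U ∈ Δ
          × ((k : ℕ) → expC Δc k (rc r) ≡ expN Δ k (rcN (orig r)))))
corollary2p2 Con ar Δc Δ n n' tr =
  (λ _ _ → equation-expansions tr) , (λ _ _ _ → definition-expansion tr)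
  where open Translation Con ar
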